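{- Let $\mathcal{C}$ be the category of cubes and let $\widehat{\mathcal{C}}$ be the category of presheaves on $\mathcal{C}$ (cubical sets). Let $\mathbb{I}$ be the interval presheaf and $\mathbb{F}$ the face-lattice presheaf (defined below), and let $\mathbb{F}^{\mathbb{I}}$ denote the exponential in $\widehat{\mathcal{C}}$. Then there is a morphism $\forall : \mathbb{F}^{\mathbb{I}} \to \mathbb{F}$ in $\widehat{\mathcal{C}}$ which is internally right adjoint to the constant map $\mathbb{F} \to \mathbb{F}^{\mathbb{I}}$, $\phi \mapsto \lambda\_.\phi$; that is, in the internal logic of $\widehat{\mathcal{C}}$, for all $\phi : \mathbb{F}$ and all $f : \mathbb{I} \to \mathbb{F}$, $$\big(\forall (i:\mathbb{I}).\ \phi \Rightarrow f(i)\big) \iff \big(\phi \Rightarrow \forall(f)\big).$$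
   Context: Fix a countably infinite set of names $i,j,k,\dots$. The category of cubes $\mathcal{C}$ has as objects finite sets of names $I, J,\dots$; a morphism $I \to J$ is a function $J \to \mathrm{dM}(I)$, where $\mathrm{dM}(I)$ is the free De Morgan algebra on generators $I$ (a De Morgan algebra is a bounded distributive lattice with an involution $x \mapsto 1-x$ satisfying the De Morgan laws). Composition is by substitution (equivalently, $\mathcal{C}$ is the opposite of the Kleisli category of the free De Morgan algebra monad on finite sets). The interval $\mathbb{I}$ is the presheaf $I \mapsto \mathrm{dM}(I)$, with restriction along a morphism $f : J \to I$ (a function $I \to \mathrm{dM}(J)$) given by the unique De Morgan algebra homomorphism $\mathrm{dM}(I) \to \mathrm{dM}(J)$ extending $f$. The face lattice $\mathbb{F}$ is the presheaf sending $I$ to the free distributive lattice (with $0,1$) on symbols $(i=0)$, $(i=1)$ for $i \in I$ quotiented by $(i=0)\wedge(i=1)=0$; equivalently, $\mathbb{F}$ is the quotient of $\mathbb{I}$ by the relation generated by $x \wedge (1-x) = 0$, or the image of the map $\mathbb{I} \to \Omega$, $i \mapsto (i = 1)$, into the subobject classifier. Each $\mathbb{F}(I)$ is a poset (lattice order), and $\Rightarrow$ in the claim denotes this order internally. -}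

module Defs where

open import Data.Nat using (ℕ)
open import Data.Fin using (Fin)
open import Data.Bool using (Bool; true; false; not)
open import Data.Product using (_×_)

-- Objects of the cube category: a finite set of names, represented (up
-- to renaming) by its cardinality n, the names being Fin n.

infixr 7 _⊓_
infixr 6 _⊔_
data DM (n : ℕ) : Set where
  var  : Fin n → DM n
  0ᵈ   : DM n
  1ᵈ   : DM n
  _⊓_  : DM n → DM n → DM n
  _⊔_  : DM n → DM n → DM n
  ~_   : DM n → DM n

-- The congruence generated by the De Morgan algebra axioms
-- (bounded distributive lattice + involution + De Morgan laws);
-- dM(n) is DM n modulo _≈ᵈ_.
infix 4 _≈ᵈ_
data _≈ᵈ_ {n : ℕ} : DM n → DM n → Set where
  refl    : ∀ {x} → x ≈ᵈ x
  sym     : ∀ {x y} → x ≈ᵈ y → y ≈ᵈ x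
  trans   : ∀ {x y z} → x ≈ᵈ y → y ≈ᵈ z → x ≈ᵈ z
  ⊓-cong  : ∀ {x x' y y'} → x ≈ᵈ x' → y ≈ᵈ y' → x ⊓ y ≈ᵈ x' ⊓ y'
  ⊔-cong  : ∀ {x x' y y'} → x ≈ᵈ x' → y ≈ᵈ y' → x ⊔ y ≈ᵈ x' ⊔ y'
  ~-cong  : ∀ {x x'} → x ≈ᵈ x' → ~ x ≈ᵈ ~ x'
  ⊓-assoc : ∀ x y z → (x ⊓ y) ⊓ z ≈ᵈ x ⊓ (y ⊓ z)
  ⊔-assoc : ∀ x y z → (x ⊔ y) ⊔ z ≈ᵈ x ⊔ (y ⊔ z)
  ⊓-comm  : ∀ x y → x ⊓ y ≈ᵈ y ⊓ x
  ⊔-comm  : ∀ x y → x ⊔ y ≈ᵈ y ⊔ x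
  ⊓-absorbs-⊔ : ∀ x y → x ⊓ (x ⊔ y) ≈ᵈ x
  ⊔-absorbs-⊓ : ∀ x y → x ⊔ (x ⊓ y) ≈ᵈ x
  ⊓-distrib-⊔ : ∀ x y z → x ⊓ (y ⊔ z) ≈ᵈ (x ⊓ y) ⊔ (x ⊓ z)
  ⊓-identity  : ∀ x → x ⊓ 1ᵈ ≈ᵈ x
  ⊔-identity  : ∀ x → x ⊔ 0ᵈ ≈ᵈ x
  ~-invol     : ∀ x → ~ (~ x) ≈ᵈ x
  ~-⊓         : ∀ x y → ~ (x ⊓ y) ≈ᵈ (~ x) ⊔ (~ y)
  ~-⊔         : ∀ x y → ~ (x ⊔ y) ≈ᵈ (~ x) ⊓ (~ y)

-- Morphisms m → n of the cube category: functions Fin n → dM(m)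
Hom : ℕ → ℕ → Set
Hom m n = Fin n → DM m

infix 4 _≈ʰ_
_≈ʰ_ : ∀ {m n} → Hom m n → Hom m n → Set
f ≈ʰ g = ∀ j → f j ≈ᵈ g j

subst : ∀ {m n} → DM n → Hom m n → DM m
subst (var i) g = g i
subst 0ᵈ g = 0ᵈ
subst 1ᵈ g = 1ᵈ
subst (x ⊓ y) g = subst x g ⊓ subst y g
subst (x ⊔ y) g = subst x g ⊔ subst y g
subst (~ x) g = ~ subst x g

infixr 9 _∘ʰ_
_∘ʰ_ : ∀ {k m n} → Hom m n → Hom k m → Hom k n
(g ∘ʰ h) j = subst (g j) h

idʰ : ∀ {n} → Hom n n
idʰ = var

-- The face lattice 𝔽(n): free bounded distributive lattice on symbols
-- (i=0), (i=1), i : Fin n, modulo (i=0) ∧ (i=1) = 0.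

infixr 7 _∧_
infixr 6 _∨_
data Face (n : ℕ) : Set where
  eq0 : Fin n → Face n
  eq1 : Fin n → Face n
  ⊥ᶠ  : Face n
  ⊤ᶠ  : Face n
  _∧_ : Face n → Face n → Face n
  _∨_ : Face n → Face n → Face n

infix 4 _≈ᶠ_
data _≈ᶠ_ {n : ℕ} : Face n → Face n → Set where
  refl    : ∀ {x} → x ≈ᶠ x
  sym     : ∀ {x y} → x ≈ᶠ y → y ≈ᶠ x
  trans   : ∀ {x y z} → x ≈ᶠ y → y ≈ᶠ z → x ≈ᶠ z
  ∧-cong  : ∀ {x x' y y'} → x ≈ᶠ x' → y ≈ᶠ y' → x ∧ y ≈ᶠ x' ∧ y'
  ∨-cong  : ∀ {x x' y y'} → x ≈ᶠ x' → y ≈ᶠ y' → x ∨ y ≈ᶠ x' ∨ y'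
  ∧-assoc : ∀ x y z → (x ∧ y) ∧ z ≈ᶠ x ∧ (y ∧ z)
  ∨-assoc : ∀ x y z → (x ∨ y) ∨ z ≈ᶠ x ∨ (y ∨ z)
  ∧-comm  : ∀ x y → x ∧ y ≈ᶠ y ∧ x
  ∨-comm  : ∀ x y → x ∨ y ≈ᶠ y ∨ x
  ∧-absorbs-∨ : ∀ x y → x ∧ (x ∨ y) ≈ᶠ x
  ∨-absorbs-∧ : ∀ x y → x ∨ (x ∧ y) ≈ᶠ x
  ∧-distrib-∨ : ∀ x y z → x ∧ (y ∨ z) ≈ᶠ (x ∧ y) ∨ (x ∧ z)
  ∧-identity  : ∀ x → x ∧ ⊤ᶠ ≈ᶠ x
  ∨-identity  : ∀ x → x ∨ ⊥ᶠ ≈ᶠ x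
  disjoint    : ∀ i → eq0 i ∧ eq1 i ≈ᶠ ⊥ᶠ

infix 4 _≤ᶠ_
_≤ᶠ_ : ∀ {n} → Face n → Face n → Set
φ ≤ᶠ ψ = φ ∧ ψ ≈ᶠ φ

-- The quotient map 𝕀 → 𝔽, x ↦ (x = 1) (with a polarity flag: false
-- computes the image of ~ x).
toFace : ∀ {n} → Bool → DM n → Face n
toFace true  (var i) = eq1 i
toFace false (var i) = eq0 i
toFace true  0ᵈ = ⊥ᶠ
toFace false 0ᵈ = ⊤ᶠ
toFace true  1ᵈ = ⊤ᶠ
toFace false 1ᵈ = ⊥ᶠ
toFace true  (x ⊓ y) = toFace true x ∧ toFace true y
toFace false (x ⊓ y) = toFace false x ∨ toFace false y
toFace true  (x ⊔ y) = toFace true x ∨ toFace true y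
toFace false (x ⊔ y) = toFace false x ∧ toFace false y
toFace b (~ x) = toFace (not b) x

_[_]ᶠ : ∀ {m n} → Face n → Hom m n → Face m
eq0 i [ g ]ᶠ = toFace false (g i)
eq1 i [ g ]ᶠ = toFace true (g i)
⊥ᶠ [ g ]ᶠ = ⊥ᶠ
⊤ᶠ [ g ]ᶠ = ⊤ᶠ
(x ∧ y) [ g ]ᶠ = (x [ g ]ᶠ) ∧ (y [ g ]ᶠ)
(x ∨ y) [ g ]ᶠ = (x [ g ]ᶠ) ∨ (y [ g ]ᶠ)

-- The exponential 𝔽^𝕀 in presheaves: 𝔽^𝕀(n) = natural transformations
-- y(n) × 𝕀 → 𝔽 (y the Yoneda embedding), up to pointwise equality.

record Exp (n : ℕ) : Set where
  field
    app     : ∀ m → Hom m n → DM m → Face m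
    app-cong : ∀ m {g g' : Hom m n} {r r' : DM m} →
               g ≈ʰ g' → r ≈ᵈ r' → app m g r ≈ᶠ app m g' r'
    natural : ∀ m k (h : Hom k m) (g : Hom m n) (r : DM m) →
              app k (g ∘ʰ h) (subst r h) ≈ᶠ (app m g r) [ h ]ᶠ
open Exp public

infix 4 _≈ᵉ_
_≈ᵉ_ : ∀ {n} → Exp n → Exp n → Set
f ≈ᵉ f' = ∀ m g r → app f m g r ≈ᶠ app f' m g r

_[_]ᵉ : ∀ {m n} → Exp n → Hom m n → Exp m
app (f [ h ]ᵉ) k g r = app f k (h ∘ʰ g) r
app-cong (f [ h ]ᵉ) k {g} {g'} p q = app-cong f k (λ j → substCong (h j) p) q
  where
  substCong : ∀ {k m} (x : DM m) {g g' : Hom k m} → g ≈ʰ g' → subst x g ≈ᵈ subst x g'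
  substCong (var i) p = p i
  substCong 0ᵈ p = refl
  substCong 1ᵈ p = refl
  substCong (x ⊓ y) p = ⊓-cong (substCong x p) (substCong y p)
  substCong (x ⊔ y) p = ⊔-cong (substCong x p) (substCong y p)
  substCong (~ x) p = ~-cong (substCong x p)
natural (f [ h ]ᵉ) k l h' g r =
  trans (app-cong f l (λ j → substAssoc (h j) g h') refl) (natural f k l h' (h ∘ʰ g) r)
  where
  substAssoc : ∀ {a b c} (x : DM b) (g : Hom c b) (h' : Hom a c) →
               subst x (λ j → subst (g j) h') ≈ᵈ subst (subst x g) h'
  substAssoc (var i) g h' = refl
  substAssoc 0ᵈ g h' = refl
  substAssoc 1ᵈ g h' = refl
  substAssoc (x ⊓ y) g h' = ⊓-cong (substAssoc x g h') (substAssoc y g h')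
  substAssoc (x ⊔ y) g h' = ⊔-cong (substAssoc x g h') (substAssoc y g h')
  substAssoc (~ x) g h' = ~-cong (substAssoc x g h')

record PshMorphism : Set where
  field
    map     : ∀ {n} → Exp n → Face n
    cong    : ∀ {n} {f f' : Exp n} → f ≈ᵉ f' → map f ≈ᶠ map f'
    natural : ∀ {m n} (h : Hom m n) (f : Exp n) → map (f [ h ]ᵉ) ≈ᶠ (map f) [ h ]ᶠ
open PshMorphism public

-- The internal statement  ∀ φ : 𝔽. ∀ f : 𝕀 → 𝔽.
--   (∀ (i : 𝕀). φ ⇒ f i) ⇔ (φ ⇒ ∀ f)
-- unfolded by Kripke–Joyal forcing at every stage n.
IsRightAdjointToConst : PshMorphism → Set
IsRightAdjointToConst A =
  ∀ n (φ : Face n) (f : Exp n) →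
    ((∀ m (g : Hom m n) (r : DM m) → φ [ g ]ᶠ ≤ᶠ app f m g r) → φ ≤ᶠ map A f)
    × (φ ≤ᶠ map A f → ∀ m (g : Hom m n) (r : DM m) → φ [ g ]ᶠ ≤ᶠ app f m g r)

-- ∀ i. ψ is computed by replacing the atoms (i=0) and (i=1) of ψ by ⊥.  This
-- is a monotone lattice map that is the identity on faces not mentioning i,
-- which gives φ ≤ ∀ i. ψ from φ ≤ ψ; and its result lies below every instance
-- ψ(r), which gives the converse.  Applied to f at the generic point of 𝕀 (the
-- fresh name at stage n + 1) it is natural, hence a map 𝔽^𝕀 → 𝔽.
module Submission where

open import Algebra.Lattice.Bundles using (Lattice)
open import Algebra.Lattice.Structures using (IsLattice)
import Algebra.Lattice.Properties.Lattice as LatticeProperties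
import Relation.Binary.Lattice as Order
import Relation.Binary.Lattice.Properties.JoinSemilattice as JoinProperties
import Relation.Binary.Lattice.Properties.MeetSemilattice as MeetProperties
import Relation.Binary.Reasoning.Setoid as SetoidReasoning
open import Data.Bool using (Bool; true; false)
open import Data.Fin using (zero; suc)
open import Data.Nat using (ℕ; suc)
open import Data.Product using (Σ; _,_)
open import Level using (0ℓ)
open import Relation.Binary.PropositionalEquality as ≡ using (_≡_; cong₂)

open import Defs

module FaceLattice {n : ℕ} where

  isLattice : IsLattice (_≈ᶠ_ {n}) _∨_ _∧_
  isLattice = record
    { isEquivalence = record { refl = refl ; sym = sym ; trans = trans }
    ; ∨-comm        = ∨-comm
    ; ∨-assoc       = ∨-assoc
    ; ∨-cong        = ∨-cong
    ; ∧-comm        = ∧-comm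
    ; ∧-assoc       = ∧-assoc
    ; ∧-cong        = ∧-cong
    ; absorptive    = ∨-absorbs-∧ , ∧-absorbs-∨
    }

  lattice : Lattice 0ℓ 0ℓ
  lattice = record { isLattice = isLattice }

  open LatticeProperties lattice public using (∧-idem)

  -- The library's order is x ≈ x ∧ y, the symmetric form of _≤ᶠ_.
  private
    module O = Order.Lattice (LatticeProperties.∨-∧-orderTheoreticLattice lattice)

  ≤ᶠ-reflexive : {φ ψ : Face n} → φ ≈ᶠ ψ → φ ≤ᶠ ψ
  ≤ᶠ-reflexive p = sym (O.reflexive p)

  ≤ᶠ-trans : {φ ψ χ : Face n} → φ ≤ᶠ ψ → ψ ≤ᶠ χ → φ ≤ᶠ χ
  ≤ᶠ-trans p q = sym (O.trans (sym p) (sym q))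

  ∧-mono : {φ φ' ψ ψ' : Face n} → φ ≤ᶠ φ' → ψ ≤ᶠ ψ' → φ ∧ ψ ≤ᶠ φ' ∧ ψ'
  ∧-mono p q = sym (MeetProperties.∧-monotonic O.meetSemilattice (sym p) (sym q))

  ∨-mono : {φ φ' ψ ψ' : Face n} → φ ≤ᶠ φ' → ψ ≤ᶠ ψ' → φ ∨ ψ ≤ᶠ φ' ∨ ψ'
  ∨-mono p q = sym (JoinProperties.∨-monotonic O.joinSemilattice (sym p) (sym q))

  ∧-zeroˡ : (φ : Face n) → ⊥ᶠ ∧ φ ≈ᶠ ⊥ᶠ
  ∧-zeroˡ φ = trans (∧-cong refl (sym (trans (∨-comm ⊥ᶠ φ) (∨-identity φ))))
                    (∧-absorbs-∨ ⊥ᶠ φ)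

  ∧-distribʳ-∨ : (φ ψ χ : Face n) → (ψ ∨ χ) ∧ φ ≈ᶠ (ψ ∧ φ) ∨ (χ ∧ φ)
  ∧-distribʳ-∨ φ ψ χ =
    trans (∧-comm (ψ ∨ χ) φ) (trans (∧-distrib-∨ φ ψ χ) (∨-cong (∧-comm φ ψ) (∧-comm φ χ)))

  ∨-∧-disjoint : {φ φ' ψ ψ' : Face n} → φ ∧ φ' ≈ᶠ ⊥ᶠ → ψ ∧ ψ' ≈ᶠ ⊥ᶠ →
                 (φ ∨ ψ) ∧ (φ' ∧ ψ') ≈ᶠ ⊥ᶠ
  ∨-∧-disjoint {φ} {φ'} {ψ} {ψ'} p q = begin
    (φ ∨ ψ) ∧ (φ' ∧ ψ')                    ≈⟨ ∧-distribʳ-∨ (φ' ∧ ψ') φ ψ ⟩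
    (φ ∧ (φ' ∧ ψ')) ∨ (ψ ∧ (φ' ∧ ψ'))      ≈⟨ ∨-cong refl (∧-cong refl (∧-comm φ' ψ')) ⟩
    (φ ∧ (φ' ∧ ψ')) ∨ (ψ ∧ (ψ' ∧ φ'))      ≈⟨ ∨-cong (sym (∧-assoc φ φ' ψ')) (sym (∧-assoc ψ ψ' φ')) ⟩
    ((φ ∧ φ') ∧ ψ') ∨ ((ψ ∧ ψ') ∧ φ')      ≈⟨ ∨-cong (∧-cong p refl) (∧-cong q refl) ⟩
    (⊥ᶠ ∧ ψ') ∨ (⊥ᶠ ∧ φ')                  ≈⟨ ∨-cong (∧-zeroˡ ψ') (∧-zeroˡ φ') ⟩
    ⊥ᶠ ∨ ⊥ᶠ                                ≈⟨ ∨-identity ⊥ᶠ ⟩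
    ⊥ᶠ                                     ∎
    where open SetoidReasoning (Lattice.setoid lattice)

open FaceLattice

toFace-disjoint : ∀ {n} (x : DM n) → toFace false x ∧ toFace true x ≈ᶠ ⊥ᶠ
toFace-disjoint (var i) = disjoint i
toFace-disjoint 0ᵈ      = trans (∧-comm ⊤ᶠ ⊥ᶠ) (∧-identity ⊥ᶠ)
toFace-disjoint 1ᵈ      = ∧-identity ⊥ᶠ
toFace-disjoint (x ⊓ y) = ∨-∧-disjoint (toFace-disjoint x) (toFace-disjoint y)
toFace-disjoint (x ⊔ y) =
  trans (∧-comm _ _) (∨-∧-disjoint (trans (∧-comm _ _) (toFace-disjoint x))
                                   (trans (∧-comm _ _) (toFace-disjoint y)))
toFace-disjoint (~ x)   = trans (∧-comm _ _) (toFace-disjoint x)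

toFace-subst : ∀ {m n} (b : Bool) (x : DM n) (h : Hom m n) →
               toFace b (subst x h) ≡ toFace b x [ h ]ᶠ
toFace-subst true  (var i) h = ≡.refl
toFace-subst false (var i) h = ≡.refl
toFace-subst true  0ᵈ      h = ≡.refl
toFace-subst false 0ᵈ      h = ≡.refl
toFace-subst true  1ᵈ      h = ≡.refl
toFace-subst false 1ᵈ      h = ≡.refl
toFace-subst true  (x ⊓ y) h = cong₂ _∧_ (toFace-subst true x h) (toFace-subst true y h)
toFace-subst false (x ⊓ y) h = cong₂ _∨_ (toFace-subst false x h) (toFace-subst false y h)
toFace-subst true  (x ⊔ y) h = cong₂ _∨_ (toFace-subst true x h) (toFace-subst true y h)
toFace-subst false (x ⊔ y) h = cong₂ _∧_ (toFace-subst false x h) (toFace-subst false y h)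
toFace-subst true  (~ x)   h = toFace-subst false x h
toFace-subst false (~ x)   h = toFace-subst true x h

-- The only relation not preserved on the nose is disjointness, whose image
-- (g i = 0) ∧ (g i = 1) is ⊥ by toFace-disjoint.
[]ᶠ-cong : ∀ {m n} {φ ψ : Face n} (g : Hom m n) → φ ≈ᶠ ψ → φ [ g ]ᶠ ≈ᶠ ψ [ g ]ᶠ
[]ᶠ-cong g refl                  = refl
[]ᶠ-cong g (sym p)               = sym ([]ᶠ-cong g p)
[]ᶠ-cong g (trans p q)           = trans ([]ᶠ-cong g p) ([]ᶠ-cong g q)
[]ᶠ-cong g (∧-cong p q)          = ∧-cong ([]ᶠ-cong g p) ([]ᶠ-cong g q)
[]ᶠ-cong g (∨-cong p q)          = ∨-cong ([]ᶠ-cong g p) ([]ᶠ-cong g q)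
[]ᶠ-cong g (∧-assoc φ ψ χ)       = ∧-assoc _ _ _
[]ᶠ-cong g (∨-assoc φ ψ χ)       = ∨-assoc _ _ _
[]ᶠ-cong g (∧-comm φ ψ)          = ∧-comm _ _
[]ᶠ-cong g (∨-comm φ ψ)          = ∨-comm _ _
[]ᶠ-cong g (∧-absorbs-∨ φ ψ)     = ∧-absorbs-∨ _ _
[]ᶠ-cong g (∨-absorbs-∧ φ ψ)     = ∨-absorbs-∧ _ _
[]ᶠ-cong g (∧-distrib-∨ φ ψ χ)   = ∧-distrib-∨ _ _ _
[]ᶠ-cong g (∧-identity φ)        = ∧-identity _
[]ᶠ-cong g (∨-identity φ)        = ∨-identity _
[]ᶠ-cong g (disjoint i)          = toFace-disjoint (g i)

[]ᶠ-mono : ∀ {m n} {φ ψ : Face n} (g : Hom m n) → φ ≤ᶠ ψ → φ [ g ]ᶠ ≤ᶠ ψ [ g ]ᶠ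
[]ᶠ-mono = []ᶠ-cong

-- Stage n + 1 is stage n extended by the fresh name zero.
weaken : ∀ {n} → Hom (suc n) n
weaken j = var (suc j)

liftʰ : ∀ {m n} → Hom m n → Hom (suc m) (suc n)
liftʰ h zero    = var zero
liftʰ h (suc j) = subst (h j) weaken

extend : ∀ {m n} → Hom m n → DM m → Hom m (suc n)
extend g r zero    = r
extend g r (suc j) = g j

forallFresh : ∀ {n} → Face (suc n) → Face n
forallFresh (eq0 zero)    = ⊥ᶠ
forallFresh (eq0 (suc j)) = eq0 j
forallFresh (eq1 zero)    = ⊥ᶠ
forallFresh (eq1 (suc j)) = eq1 j
forallFresh ⊥ᶠ            = ⊥ᶠ
forallFresh ⊤ᶠ            = ⊤ᶠ
forallFresh (φ ∧ ψ)       = forallFresh φ ∧ forallFresh ψ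
forallFresh (φ ∨ ψ)       = forallFresh φ ∨ forallFresh ψ

forallFresh-cong : ∀ {n} {φ ψ : Face (suc n)} → φ ≈ᶠ ψ → forallFresh φ ≈ᶠ forallFresh ψ
forallFresh-cong refl                = refl
forallFresh-cong (sym p)             = sym (forallFresh-cong p)
forallFresh-cong (trans p q)         = trans (forallFresh-cong p) (forallFresh-cong q)
forallFresh-cong (∧-cong p q)        = ∧-cong (forallFresh-cong p) (forallFresh-cong q)
forallFresh-cong (∨-cong p q)        = ∨-cong (forallFresh-cong p) (forallFresh-cong q)
forallFresh-cong (∧-assoc φ ψ χ)     = ∧-assoc _ _ _
forallFresh-cong (∨-assoc φ ψ χ)     = ∨-assoc _ _ _
forallFresh-cong (∧-comm φ ψ)        = ∧-comm _ _
forallFresh-cong (∨-comm φ ψ)        = ∨-comm _ _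
forallFresh-cong (∧-absorbs-∨ φ ψ)   = ∧-absorbs-∨ _ _
forallFresh-cong (∨-absorbs-∧ φ ψ)   = ∨-absorbs-∧ _ _
forallFresh-cong (∧-distrib-∨ φ ψ χ) = ∧-distrib-∨ _ _ _
forallFresh-cong (∧-identity φ)      = ∧-identity _
forallFresh-cong (∨-identity φ)      = ∨-identity _
forallFresh-cong (disjoint zero)     = ∧-idem ⊥ᶠ
forallFresh-cong (disjoint (suc i))  = disjoint i

forallFresh-mono : ∀ {n} {φ ψ : Face (suc n)} → φ ≤ᶠ ψ → forallFresh φ ≤ᶠ forallFresh ψ
forallFresh-mono = forallFresh-cong

forallFresh-weaken : ∀ {n} (φ : Face n) → forallFresh (φ [ weaken ]ᶠ) ≈ᶠ φ
forallFresh-weaken (eq0 i) = refl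
forallFresh-weaken (eq1 i) = refl
forallFresh-weaken ⊥ᶠ      = refl
forallFresh-weaken ⊤ᶠ      = refl
forallFresh-weaken (φ ∧ ψ) = ∧-cong (forallFresh-weaken φ) (forallFresh-weaken ψ)
forallFresh-weaken (φ ∨ ψ) = ∨-cong (forallFresh-weaken φ) (forallFresh-weaken ψ)

forallFresh-toFace-weaken : ∀ {n} (b : Bool) (x : DM n) →
                            forallFresh (toFace b (subst x weaken)) ≈ᶠ toFace b x
forallFresh-toFace-weaken b x rewrite toFace-subst b x weaken =
  forallFresh-weaken (toFace b x)

forallFresh-lift : ∀ {m n} (h : Hom m n) (φ : Face (suc n)) →
                   forallFresh (φ [ liftʰ h ]ᶠ) ≈ᶠ forallFresh φ [ h ]ᶠ
forallFresh-lift h (eq0 zero)    = refl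
forallFresh-lift h (eq0 (suc j)) = forallFresh-toFace-weaken false (h j)
forallFresh-lift h (eq1 zero)    = refl
forallFresh-lift h (eq1 (suc j)) = forallFresh-toFace-weaken true (h j)
forallFresh-lift h ⊥ᶠ            = refl
forallFresh-lift h ⊤ᶠ            = refl
forallFresh-lift h (φ ∧ ψ)       = ∧-cong (forallFresh-lift h φ) (forallFresh-lift h ψ)
forallFresh-lift h (φ ∨ ψ)       = ∨-cong (forallFresh-lift h φ) (forallFresh-lift h ψ)

forallFresh-≤-instance : ∀ {m n} (g : Hom m n) (r : DM m) (φ : Face (suc n)) →
                         forallFresh φ [ g ]ᶠ ≤ᶠ φ [ extend g r ]ᶠ
forallFresh-≤-instance g r (eq0 zero)    = ∧-zeroˡ _
forallFresh-≤-instance g r (eq0 (suc j)) = ≤ᶠ-reflexive refl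
forallFresh-≤-instance g r (eq1 zero)    = ∧-zeroˡ _
forallFresh-≤-instance g r (eq1 (suc j)) = ≤ᶠ-reflexive refl
forallFresh-≤-instance g r ⊥ᶠ            = ≤ᶠ-reflexive refl
forallFresh-≤-instance g r ⊤ᶠ            = ≤ᶠ-reflexive refl
forallFresh-≤-instance g r (φ ∧ ψ)       =
  ∧-mono (forallFresh-≤-instance g r φ) (forallFresh-≤-instance g r ψ)
forallFresh-≤-instance g r (φ ∨ ψ)       =
  ∨-mono (forallFresh-≤-instance g r φ) (forallFresh-≤-instance g r ψ)

atGeneric : ∀ {n} → Exp n → Face (suc n)
atGeneric f = app f _ weaken (var zero)

-- weaken ∘ʰ extend g r is g and var zero is sent to r, so naturality of f
-- computes every value of f from its generic value.
atGeneric-extend : ∀ {m n} (f : Exp n) (g : Hom m n) (r : DM m) →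
                   atGeneric f [ extend g r ]ᶠ ≈ᶠ app f m g r
atGeneric-extend f g r = sym (natural f _ _ (extend g r) weaken (var zero))

universal : PshMorphism
map universal f = forallFresh (atGeneric f)
cong universal p = forallFresh-cong (p _ weaken (var zero))
natural universal h f =
  trans (forallFresh-cong (natural f _ _ (liftʰ h) weaken (var zero)))
        (forallFresh-lift h (atGeneric f))

universal-intro : ∀ {n} (φ : Face n) (f : Exp n) →
                  (∀ m (g : Hom m n) (r : DM m) → φ [ g ]ᶠ ≤ᶠ app f m g r) →
                  φ ≤ᶠ map universal f
universal-intro φ f below =
  ≤ᶠ-trans (≤ᶠ-reflexive (sym (forallFresh-weaken φ)))
           (forallFresh-mono (below _ weaken (var zero)))

universal-elim : ∀ {n} (φ : Face n) (f : Exp n) → φ ≤ᶠ map universal f →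
                 ∀ m (g : Hom m n) (r : DM m) → φ [ g ]ᶠ ≤ᶠ app f m g r
universal-elim φ f φ≤∀f m g r =
  ≤ᶠ-trans ([]ᶠ-mono g φ≤∀f)
    (≤ᶠ-trans (forallFresh-≤-instance g r (atGeneric f))
              (≤ᶠ-reflexive (atGeneric-extend f g r)))

mainTheorem1 : Σ PshMorphism IsRightAdjointToConst
mainTheorem1 = universal , λ n φ f → universal-intro φ f , universal-elim φ f
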